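{- For all integers $n\geq 1$, $ac_0(n)=2\cdot f_3(n-2)$.
   Context: A composition of $n$ of length $s$ is a sequence $\sigma=(\sigma_1,\ldots,\sigma_s)$ of positive integers with $\sum_i\sigma_i=n$; the empty composition is the unique composition of $0$ (length $0$). A composition is anti-palindromic if $\sigma_i\neq\sigma_{s-i+1}$ for all $i$ with $i\neq\frac{s+1}{2}$ (the empty composition is vacuously anti-palindromic). $ac_0(n)$ denotes the number of anti-palindromic compositions of $n$ of even length. The tribonacci numbers are defined by $f_3(n)=0$ for $n<1$, $f_3(1)=1$, and $f_3(n)=f_3(n-1)+f_3(n-2)+f_3(n-3)$ for $n\geq 2$. -}

module Defs where

open import Data.Nat using (ℕ; zero; suc; _+_; _∸_; _≡ᵇ_)
open import Data.Bool using (Bool; true; false; _∧_; _∨_; not)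
open import Data.List using (List; []; _∷_; length; reverse; concatMap; map; upTo)

-- The first argument is fuel (≥ m) for structural recursion.
compsFuel : ℕ → ℕ → List (List ℕ)
compsFuel _ zero = [] ∷ []
compsFuel zero (suc m) = []
compsFuel (suc f) (suc m) =
  concatMap (λ k → map (suc k ∷_) (compsFuel f (m ∸ k))) (upTo (suc m))

compositions : ℕ → List (List ℕ)
compositions n = compsFuel n n

-- Pairing σ with reverse σ gives exactly the pairs (σ_i, σ_{s-1-i}).
antiPalAux : ℕ → ℕ → List ℕ → List ℕ → Bool
antiPalAux s i (a ∷ as) (b ∷ bs) =
  ((i + i + 1 ≡ᵇ s) ∨ not (a ≡ᵇ b)) ∧ antiPalAux s (suc i) as bs
antiPalAux s i _ _ = true

isAntiPalindromic : List ℕ → Bool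
isAntiPalindromic σ = antiPalAux (length σ) 0 σ (reverse σ)

isEven : ℕ → Bool
isEven zero = true
isEven (suc zero) = false
isEven (suc (suc n)) = isEven n

count : {A : Set} → (A → Bool) → List A → ℕ
count p [] = 0
count p (x ∷ xs) with p x
... | true = suc (count p xs)
... | false = count p xs

ac₀ : ℕ → ℕ
ac₀ n = count (λ σ → isEven (length σ) ∧ isAntiPalindromic σ) (compositions n)

-- Tribonacci: f₃(n) = 0 for n < 1, f₃(1) = 1, f₃(n) = f₃(n-1)+f₃(n-2)+f₃(n-3).
-- Here indexed by ℕ; f₃(0) = 0, and f₃(2) = f₃(1)+f₃(0)+f₃(-1) = 1.
f₃ : ℕ → ℕ
f₃ zero = 0
f₃ (suc zero) = 1
f₃ (suc (suc zero)) = 1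
f₃ (suc (suc (suc n))) = f₃ (suc (suc n)) + f₃ (suc n) + f₃ n

-- An even-length anti-palindromic composition of m + 2 is an outer pair of distinct parts
-- (a, b) wrapped around a shorter one, so ac₀(m + 2) = Σ_{s + r = m} q(s) ac₀(r), where q(s)
-- counts the ordered pairs a ≠ b with a + b = s + 2. Since q(s + 2) = q(s) + 2 this yields
-- ac₀(n + 4) = ac₀(n + 2) + 2 Σ_{r ≤ n + 1} ac₀(r), and the tribonacci numbers satisfy the
-- matching recurrence f₃(n + 2) = f₃(n) + Σ_{r ≤ n + 1} ac₀(r), proved alongside.
module Submission where

open import Defs
open import Data.Nat using (ℕ; _≤_; _*_; _∸_)
open import Relation.Binary.PropositionalEquality using (_≡_)

open import Data.Bool using (Bool; true; false; _∧_; not)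
open import Data.Bool.Properties using (∧-assoc; ∧-identityʳ; ∧-zeroʳ)
open import Data.List using (List; []; _∷_; _++_; length; reverse; concatMap; map; upTo; applyUpTo)
open import Data.List.Properties using (concatMap-cong; map-cong; length-++-sucʳ; ++-identityʳ; unfold-reverse; reverse-++; length-reverse)
open import Data.Nat using (zero; suc; _+_; _<_; _≡ᵇ_; z≤n; s≤s)
open import Data.Nat.Induction using (<-rec)
open import Function using (_∘_)
open import Data.Nat.ListAction using (sum)
open import Data.Nat.Properties using (+-identityʳ; +-assoc; +-suc; +-comm; *-distribˡ-+; *-distribʳ-+; ≤-refl; ≤-trans; m≤n⇒m≤1+n; m∸n≤m; suc-injective)
open import Data.Nat.Solver using (module +-*-Solver)
open import Relation.Binary.PropositionalEquality using (refl; sym; trans; cong; cong₂; module ≡-Reasoning)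
open +-*-Solver using (solve; _:+_; _:*_; _:=_; con)
open ≡-Reasoning

indicator : Bool → ℕ
indicator true = 1
indicator false = 0

module _ {A : Set} where

  count-++ : (p : A → Bool) (xs ys : List A) → count p (xs ++ ys) ≡ count p xs + count p ys
  count-++ p [] ys = refl
  count-++ p (x ∷ xs) ys with p x
  ... | true = cong suc (count-++ p xs ys)
  ... | false = count-++ p xs ys

  count-cong : {p q : A → Bool} → (∀ x → p x ≡ q x) → (xs : List A) → count p xs ≡ count q xs
  count-cong e [] = refl
  count-cong {p} {q} e (x ∷ xs) with p x | q x | e x
  ... | true | true | refl = cong suc (count-cong e xs)
  ... | false | false | refl = count-cong e xs

  count-const-false : (xs : List A) → count (λ _ → false) xs ≡ 0
  count-const-false [] = refl
  count-const-false (x ∷ xs) = count-const-false xs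

  count-∧ˡ : (c : Bool) (p : A → Bool) (xs : List A) → count (λ x → c ∧ p x) xs ≡ indicator c * count p xs
  count-∧ˡ true p xs = sym (+-identityʳ _)
  count-∧ˡ false p xs = count-const-false xs

  count-singleton : (x : A) (p : A → Bool) → count p (x ∷ []) ≡ indicator (p x)
  count-singleton x p with p x
  ... | true = refl
  ... | false = refl

module _ {A B : Set} where

  count-map : (p : B → Bool) (f : A → B) (xs : List A) → count p (map f xs) ≡ count (λ x → p (f x)) xs
  count-map p f [] = refl
  count-map p f (x ∷ xs) with p (f x)
  ... | true = cong suc (count-map p f xs)
  ... | false = count-map p f xs

  count-concatMap : (p : B → Bool) (F : A → List B) (xs : List A) →
                    count p (concatMap F xs) ≡ sum (map (λ x → count p (F x)) xs)
  count-concatMap p F [] = refl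
  count-concatMap p F (x ∷ xs) =
    trans (count-++ p (F x) (concatMap F xs)) (cong (count p (F x) +_) (count-concatMap p F xs))

  map-applyUpTo : (f : A → B) (g : ℕ → A) (n : ℕ) → map f (applyUpTo g n) ≡ applyUpTo (λ k → f (g k)) n
  map-applyUpTo f g zero = refl
  map-applyUpTo f g (suc n) = cong (f (g 0) ∷_) (map-applyUpTo f (λ k → g (suc k)) n)

convolve : ℕ → (ℕ → ℕ → ℕ) → ℕ
convolve zero F = F 0 0
convolve (suc n) F = F 0 (suc n) + convolve n (λ k l → F (suc k) l)

sum-applyUpTo-antidiagonal : (m : ℕ) (F : ℕ → ℕ → ℕ) →
                             sum (applyUpTo (λ k → F k (m ∸ k)) (suc m)) ≡ convolve m F
sum-applyUpTo-antidiagonal zero F = +-identityʳ (F 0 0)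
sum-applyUpTo-antidiagonal (suc m) F = cong (F 0 (suc m) +_) (sum-applyUpTo-antidiagonal m (λ k → F (suc k)))

convolve-cong : (n : ℕ) {F G : ℕ → ℕ → ℕ} → (∀ k l → l ≤ n → F k l ≡ G k l) → convolve n F ≡ convolve n G
convolve-cong zero e = e 0 0 z≤n
convolve-cong (suc n) e =
  cong₂ _+_ (e 0 (suc n) ≤-refl) (convolve-cong n (λ k l l≤n → e (suc k) l (m≤n⇒m≤1+n l≤n)))

convolve-+ : (n : ℕ) (F G : ℕ → ℕ → ℕ) → convolve n (λ k l → F k l + G k l) ≡ convolve n F + convolve n G
convolve-+ zero F G = refl
convolve-+ (suc n) F G =
  trans (cong (F 0 (suc n) + G 0 (suc n) +_) (convolve-+ n (λ k → F (suc k)) (λ k → G (suc k))))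
        (interchange (F 0 (suc n)) (G 0 (suc n)) (convolve n (λ k → F (suc k))) (convolve n (λ k → G (suc k))))
  where
  interchange : ∀ a b c d → a + b + (c + d) ≡ a + c + (b + d)
  interchange = solve 4 (λ a b c d → a :+ b :+ (c :+ d) := a :+ c :+ (b :+ d)) refl

convolve-*ˡ : (n c : ℕ) (F : ℕ → ℕ → ℕ) → convolve n (λ k l → c * F k l) ≡ c * convolve n F
convolve-*ˡ zero c F = refl
convolve-*ˡ (suc n) c F =
  trans (cong (c * F 0 (suc n) +_) (convolve-*ˡ n c _)) (sym (*-distribˡ-+ c (F 0 (suc n)) _))

convolve-*ʳ : (n c : ℕ) (F : ℕ → ℕ → ℕ) → convolve n (λ k l → F k l * c) ≡ convolve n F * c
convolve-*ʳ zero c F = refl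
convolve-*ʳ (suc n) c F =
  trans (cong (F 0 (suc n) * c +_) (convolve-*ʳ n c _)) (sym (*-distribʳ-+ c (F 0 (suc n)) _))

convolve-last : (n : ℕ) (F : ℕ → ℕ → ℕ) → convolve (suc n) F ≡ convolve n (λ k l → F k (suc l)) + F (suc n) 0
convolve-last zero F = refl
convolve-last (suc n) F =
  trans (cong (F 0 (suc (suc n)) +_) (convolve-last n (λ k → F (suc k)))) (sym (+-assoc (F 0 (suc (suc n))) _ _))

convolve-flip : (n : ℕ) (F : ℕ → ℕ → ℕ) → convolve n F ≡ convolve n (λ k l → F l k)
convolve-flip zero F = refl
convolve-flip (suc n) F =
  trans (cong (F 0 (suc n) +_) (convolve-flip n (λ k → F (suc k))))
        (trans (+-comm (F 0 (suc n)) _) (sym (convolve-last n (λ k l → F l k))))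

convolve-assoc : (n : ℕ) (T : ℕ → ℕ → ℕ → ℕ) →
                 convolve n (λ k l → convolve l (λ j r → T k j r)) ≡ convolve n (λ s r → convolve s (λ k j → T k j r))
convolve-assoc zero T = refl
convolve-assoc (suc n) T = begin
  (T 0 0 (suc n) + convolve n (λ j → T 0 (suc j))) + convolve n (λ k l → convolve l (T (suc k)))
    ≡⟨ cong (T 0 0 (suc n) + convolve n (λ j → T 0 (suc j)) +_) (convolve-assoc n (λ k → T (suc k))) ⟩
  (T 0 0 (suc n) + convolve n (λ j → T 0 (suc j))) + convolve n (λ s r → convolve s (λ k j → T (suc k) j r))
    ≡⟨ +-assoc (T 0 0 (suc n)) _ _ ⟩
  T 0 0 (suc n) + (convolve n (λ j → T 0 (suc j)) + convolve n (λ s r → convolve s (λ k j → T (suc k) j r)))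
    ≡⟨ cong (T 0 0 (suc n) +_) (sym (convolve-+ n _ _)) ⟩
  T 0 0 (suc n) + convolve n (λ s r → T 0 (suc s) r + convolve s (λ k j → T (suc k) j r)) ∎

convolve-swap : (n : ℕ) (T : ℕ → ℕ → ℕ → ℕ) →
                convolve n (λ k l → convolve l (λ j r → T k j r)) ≡ convolve n (λ j l → convolve l (λ k r → T k j r))
convolve-swap n T =
  trans (convolve-assoc n T)
        (trans (convolve-cong n (λ s r _ → convolve-flip s (λ k j → T k j r)))
               (sym (convolve-assoc n (λ j k r → T k j r))))

compsFuel-irrelevant : ∀ {f g} m → m ≤ f → m ≤ g → compsFuel f m ≡ compsFuel g m
compsFuel-irrelevant zero _ _ = refl
compsFuel-irrelevant (suc m) (s≤s m≤f) (s≤s m≤g) =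
  concatMap-cong (λ k → cong (map (suc k ∷_)) (compsFuel-irrelevant (m ∸ k)
                                                 (≤-trans (m∸n≤m m k) m≤f) (≤-trans (m∸n≤m m k) m≤g)))
                 (upTo (suc m))

compositions-suc : ∀ m → compositions (suc m) ≡ concatMap (λ k → map (suc k ∷_) (compositions (m ∸ k))) (upTo (suc m))
compositions-suc m =
  concatMap-cong (λ k → cong (map (suc k ∷_)) (compsFuel-irrelevant (m ∸ k) (m∸n≤m m k) ≤-refl)) (upTo (suc m))

countComps : (List ℕ → Bool) → ℕ → ℕ
countComps h n = count h (compositions n)

countComps-zero : (h : List ℕ → Bool) → countComps h 0 ≡ indicator (h [])
countComps-zero h = count-singleton [] h

countComps-first : (m : ℕ) (h : List ℕ → Bool) →
                   countComps h (suc m) ≡ convolve m (λ k l → countComps (λ ρ → h (suc k ∷ ρ)) l)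
countComps-first m h = begin
  count h (compositions (suc m))
    ≡⟨ cong (count h) (compositions-suc m) ⟩
  count h (concatMap (λ k → map (suc k ∷_) (compositions (m ∸ k))) (upTo (suc m)))
    ≡⟨ count-concatMap h (λ k → map (suc k ∷_) (compositions (m ∸ k))) (upTo (suc m)) ⟩
  sum (map (λ k → count h (map (suc k ∷_) (compositions (m ∸ k)))) (upTo (suc m)))
    ≡⟨ cong sum (map-cong (λ k → count-map h (suc k ∷_) (compositions (m ∸ k))) (upTo (suc m))) ⟩
  sum (map (λ k → countComps (λ ρ → h (suc k ∷ ρ)) (m ∸ k)) (upTo (suc m)))
    ≡⟨ cong sum (map-applyUpTo _ (λ k → k) (suc m)) ⟩
  sum (applyUpTo (λ k → countComps (λ ρ → h (suc k ∷ ρ)) (m ∸ k)) (suc m))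
    ≡⟨ sum-applyUpTo-antidiagonal m (λ k l → countComps (λ ρ → h (suc k ∷ ρ)) l) ⟩
  convolve m (λ k l → countComps (λ ρ → h (suc k ∷ ρ)) l) ∎

-- Splitting off the last part instead: peel the first part, apply the claim to the rest, and
-- exchange the order of the two resulting sums.
countComps-last : (m : ℕ) (h : List ℕ → Bool) →
                  countComps h (suc m) ≡ convolve m (λ k l → countComps (λ ρ → h (ρ ++ suc k ∷ [])) l)
countComps-last = <-rec LastPart step
  where
  LastPart : ℕ → Set
  LastPart m = (h : List ℕ → Bool) →
               countComps h (suc m) ≡ convolve m (λ k l → countComps (λ ρ → h (ρ ++ suc k ∷ [])) l)

  step : ∀ m → (∀ {l} → l < m → LastPart l) → LastPart m
  step zero _ h =
    trans (countComps-first 0 h)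
          (trans (countComps-zero (λ ρ → h (1 ∷ ρ))) (sym (countComps-zero (λ ρ → h (ρ ++ 1 ∷ [])))))
  step (suc m) ih h = begin
    countComps h (suc (suc m))
      ≡⟨ countComps-first (suc m) h ⟩
    convolve (suc m) (λ k l → countComps (λ ρ → h (suc k ∷ ρ)) l)
      ≡⟨ convolve-last m (λ k l → countComps (λ ρ → h (suc k ∷ ρ)) l) ⟩
    convolve m (λ k l → countComps (λ ρ → h (suc k ∷ ρ)) (suc l)) + countComps (λ ρ → h (suc (suc m) ∷ ρ)) 0
      ≡⟨ cong₂ _+_ (convolve-cong m (λ k l l≤m → ih (s≤s l≤m) (λ ρ → h (suc k ∷ ρ))))
                   (trans (countComps-zero (λ ρ → h (suc (suc m) ∷ ρ)))
                          (sym (countComps-zero (λ ρ → h (ρ ++ suc (suc m) ∷ []))))) ⟩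
    convolve m (λ k l → convolve l (λ j r → countComps (λ ρ → h (suc k ∷ ρ ++ suc j ∷ [])) r)) + lastTerm
      ≡⟨ cong (_+ lastTerm) (convolve-swap m _) ⟩
    convolve m (λ j l → convolve l (λ k r → countComps (λ ρ → h (suc k ∷ ρ ++ suc j ∷ [])) r)) + lastTerm
      ≡⟨ cong (_+ lastTerm) (convolve-cong m (λ j l _ → sym (countComps-first l (λ ρ → h (ρ ++ suc j ∷ []))))) ⟩
    convolve m (λ j l → countComps (λ ρ → h (ρ ++ suc j ∷ [])) (suc l)) + lastTerm
      ≡⟨ sym (convolve-last m (λ j l → countComps (λ ρ → h (ρ ++ suc j ∷ [])) l)) ⟩
    convolve (suc m) (λ j l → countComps (λ ρ → h (ρ ++ suc j ∷ [])) l) ∎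
    where
    lastTerm : ℕ
    lastTerm = countComps (λ ρ → h (ρ ++ suc (suc m) ∷ [])) 0

isEvenAntiPalindromic : List ℕ → Bool
isEvenAntiPalindromic σ = isEven (length σ) ∧ isAntiPalindromic σ

pointwiseDistinct : List ℕ → List ℕ → Bool
pointwiseDistinct (a ∷ as) (b ∷ bs) = not (a ≡ᵇ b) ∧ pointwiseDistinct as bs
pointwiseDistinct _ _ = true

isEven-2i+1 : ∀ i → isEven (i + i + 1) ≡ false
isEven-2i+1 zero = refl
isEven-2i+1 (suc i) rewrite +-suc i i = isEven-2i+1 i

≡ᵇ-false-by-parity : ∀ m s → isEven m ≡ false → isEven s ≡ true → (m ≡ᵇ s) ≡ false
≡ᵇ-false-by-parity zero s () _
≡ᵇ-false-by-parity (suc zero) zero _ _ = refl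
≡ᵇ-false-by-parity (suc zero) (suc zero) _ ()
≡ᵇ-false-by-parity (suc zero) (suc (suc s)) _ _ = refl
≡ᵇ-false-by-parity (suc (suc m)) zero _ _ = refl
≡ᵇ-false-by-parity (suc (suc m)) (suc zero) _ ()
≡ᵇ-false-by-parity (suc (suc m)) (suc (suc s)) em es = ≡ᵇ-false-by-parity m s em es

-- For even length s no position i is the middle one (2i + 1 = s).
antiPalAux-even : ∀ s i xs ys → isEven s ≡ true → antiPalAux s i xs ys ≡ pointwiseDistinct xs ys
antiPalAux-even s i [] ys _ = refl
antiPalAux-even s i (x ∷ xs) [] _ = refl
antiPalAux-even s i (x ∷ xs) (y ∷ ys) es
  rewrite ≡ᵇ-false-by-parity (i + i + 1) s (isEven-2i+1 i) es =
  cong (not (x ≡ᵇ y) ∧_) (antiPalAux-even s (suc i) xs ys es)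

isEvenAntiPalindromic-pointwise : ∀ σ → isEvenAntiPalindromic σ ≡ isEven (length σ) ∧ pointwiseDistinct σ (reverse σ)
isEvenAntiPalindromic-pointwise σ with isEven (length σ) in even
... | true = antiPalAux-even (length σ) 0 σ (reverse σ) even
... | false = refl

pointwiseDistinct-snoc : ∀ xs ys x y → length xs ≡ length ys →
                         pointwiseDistinct (xs ++ x ∷ []) (ys ++ y ∷ []) ≡ pointwiseDistinct xs ys ∧ not (x ≡ᵇ y)
pointwiseDistinct-snoc [] [] x y _ = ∧-identityʳ (not (x ≡ᵇ y))
pointwiseDistinct-snoc (a ∷ xs) (b ∷ ys) x y e =
  trans (cong (not (a ≡ᵇ b) ∧_) (pointwiseDistinct-snoc xs ys x y (suc-injective e)))
        (sym (∧-assoc (not (a ≡ᵇ b)) _ _))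

≡ᵇ-sym : ∀ a b → (a ≡ᵇ b) ≡ (b ≡ᵇ a)
≡ᵇ-sym zero zero = refl
≡ᵇ-sym zero (suc b) = refl
≡ᵇ-sym (suc a) zero = refl
≡ᵇ-sym (suc a) (suc b) = ≡ᵇ-sym a b

isEvenAntiPalindromic-wrap : ∀ a ρ b →
                             isEvenAntiPalindromic (a ∷ ρ ++ b ∷ []) ≡ not (a ≡ᵇ b) ∧ isEvenAntiPalindromic ρ
isEvenAntiPalindromic-wrap a ρ b = begin
  isEvenAntiPalindromic (a ∷ ρ ++ b ∷ [])
    ≡⟨ isEvenAntiPalindromic-pointwise (a ∷ ρ ++ b ∷ []) ⟩
  isEven (suc (length (ρ ++ b ∷ []))) ∧ pointwiseDistinct (a ∷ ρ ++ b ∷ []) (reverse (a ∷ ρ ++ b ∷ []))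
    ≡⟨ cong₂ (λ len rev → isEven (suc len) ∧ pointwiseDistinct (a ∷ ρ ++ b ∷ []) rev)
             (trans (length-++-sucʳ ρ b []) (cong (suc ∘ length) (++-identityʳ ρ)))
             (trans (unfold-reverse a (ρ ++ b ∷ [])) (cong (_++ a ∷ []) (reverse-++ ρ (b ∷ [])))) ⟩
  isEven (length ρ) ∧ (not (a ≡ᵇ b) ∧ pointwiseDistinct (ρ ++ b ∷ []) (reverse ρ ++ a ∷ []))
    ≡⟨ cong (λ d → isEven (length ρ) ∧ (not (a ≡ᵇ b) ∧ d))
            (trans (pointwiseDistinct-snoc ρ (reverse ρ) b a (sym (length-reverse ρ)))
                   (cong (λ e → pointwiseDistinct ρ (reverse ρ) ∧ not e) (≡ᵇ-sym b a))) ⟩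
  isEven (length ρ) ∧ (not (a ≡ᵇ b) ∧ (pointwiseDistinct ρ (reverse ρ) ∧ not (a ≡ᵇ b)))
    ≡⟨ ∧-pull (isEven (length ρ)) (not (a ≡ᵇ b)) (pointwiseDistinct ρ (reverse ρ)) ⟩
  not (a ≡ᵇ b) ∧ (isEven (length ρ) ∧ pointwiseDistinct ρ (reverse ρ))
    ≡⟨ cong (not (a ≡ᵇ b) ∧_) (sym (isEvenAntiPalindromic-pointwise ρ)) ⟩
  not (a ≡ᵇ b) ∧ isEvenAntiPalindromic ρ ∎
  where
  ∧-pull : ∀ e x y → e ∧ (x ∧ (y ∧ x)) ≡ x ∧ (e ∧ y)
  ∧-pull e true y = cong (e ∧_) (∧-identityʳ y)
  ∧-pull e false y = ∧-zeroʳ e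

distinctPairs : ℕ → ℕ
distinctPairs s = convolve s (λ k j → indicator (not (k ≡ᵇ j)))

distinctPairs-suc-suc : ∀ s → distinctPairs (suc (suc s)) ≡ 2 + distinctPairs s
distinctPairs-suc-suc s =
  cong suc (trans (convolve-last s (λ k j → indicator (not (suc k ≡ᵇ j)))) (+-comm (distinctPairs s) 1))

wrapped-count : ∀ k l → countComps (λ ρ → isEvenAntiPalindromic (suc k ∷ ρ)) (suc l)
                        ≡ convolve l (λ j r → indicator (not (k ≡ᵇ j)) * ac₀ r)
wrapped-count k l =
  trans (countComps-last l (λ ρ → isEvenAntiPalindromic (suc k ∷ ρ)))
        (convolve-cong l (λ j r _ →
          trans (count-cong (λ ρ → isEvenAntiPalindromic-wrap (suc k) ρ (suc j)) (compositions r))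
                (count-∧ˡ (not (k ≡ᵇ j)) isEvenAntiPalindromic (compositions r))))

ac₀-suc-suc : ∀ m → ac₀ (suc (suc m)) ≡ convolve m (λ s r → distinctPairs s * ac₀ r)
ac₀-suc-suc m = begin
  ac₀ (suc (suc m))
    ≡⟨ countComps-first (suc m) isEvenAntiPalindromic ⟩
  convolve (suc m) (λ k l → countComps (λ ρ → isEvenAntiPalindromic (suc k ∷ ρ)) l)
    ≡⟨ convolve-last m (λ k l → countComps (λ ρ → isEvenAntiPalindromic (suc k ∷ ρ)) l) ⟩
  convolve m (λ k l → countComps (λ ρ → isEvenAntiPalindromic (suc k ∷ ρ)) (suc l)) + 0
    ≡⟨ +-identityʳ _ ⟩
  convolve m (λ k l → countComps (λ ρ → isEvenAntiPalindromic (suc k ∷ ρ)) (suc l))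
    ≡⟨ convolve-cong m (λ k l _ → wrapped-count k l) ⟩
  convolve m (λ k l → convolve l (λ j r → indicator (not (k ≡ᵇ j)) * ac₀ r))
    ≡⟨ convolve-assoc m _ ⟩
  convolve m (λ s r → convolve s (λ k j → indicator (not (k ≡ᵇ j)) * ac₀ r))
    ≡⟨ convolve-cong m (λ s r _ → convolve-*ʳ s (ac₀ r) _) ⟩
  convolve m (λ s r → distinctPairs s * ac₀ r) ∎

partialSum-ac₀ : ℕ → ℕ
partialSum-ac₀ n = convolve n (λ _ r → ac₀ r)

ac₀-recurrence : ∀ n → ac₀ (suc (suc (suc (suc n)))) ≡ ac₀ (suc (suc n)) + 2 * partialSum-ac₀ (suc n)
ac₀-recurrence n = begin
  ac₀ (suc (suc (suc (suc n))))
    ≡⟨ ac₀-suc-suc (suc (suc n)) ⟩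
  2 * ac₀ (suc n) + convolve n (λ s r → distinctPairs (suc (suc s)) * ac₀ r)
    ≡⟨ cong (2 * ac₀ (suc n) +_) (convolve-cong n (λ s r _ →
         trans (cong (_* ac₀ r) (distinctPairs-suc-suc s)) (*-distribʳ-+ (ac₀ r) 2 (distinctPairs s)))) ⟩
  2 * ac₀ (suc n) + convolve n (λ s r → 2 * ac₀ r + distinctPairs s * ac₀ r)
    ≡⟨ cong (2 * ac₀ (suc n) +_) (trans (convolve-+ n _ _) (cong₂ _+_ (convolve-*ˡ n 2 (λ _ r → ac₀ r))
                                                                       (sym (ac₀-suc-suc n)))) ⟩
  2 * ac₀ (suc n) + (2 * partialSum-ac₀ n + ac₀ (suc (suc n)))
    ≡⟨ regroup (ac₀ (suc n)) (partialSum-ac₀ n) (ac₀ (suc (suc n))) ⟩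
  ac₀ (suc (suc n)) + 2 * (ac₀ (suc n) + partialSum-ac₀ n) ∎
  where
  regroup : ∀ a c e → 2 * a + (2 * c + e) ≡ e + 2 * (a + c)
  regroup = solve 3 (λ a c e → con 2 :* a :+ (con 2 :* c :+ e) := e :+ con 2 :* (a :+ c)) refl

mutual
  ac₀-suc-suc-tribonacci : ∀ n → ac₀ (suc (suc n)) ≡ 2 * f₃ n
  ac₀-suc-suc-tribonacci zero = refl
  ac₀-suc-suc-tribonacci (suc zero) = refl
  ac₀-suc-suc-tribonacci (suc (suc n)) = begin
    ac₀ (suc (suc (suc (suc n))))
      ≡⟨ ac₀-recurrence n ⟩
    ac₀ (suc (suc n)) + 2 * partialSum-ac₀ (suc n)
      ≡⟨ cong (_+ 2 * partialSum-ac₀ (suc n)) (ac₀-suc-suc-tribonacci n) ⟩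
    2 * f₃ n + 2 * partialSum-ac₀ (suc n)
      ≡⟨ sym (*-distribˡ-+ 2 (f₃ n) _) ⟩
    2 * (f₃ n + partialSum-ac₀ (suc n))
      ≡⟨ cong (2 *_) (trans (+-comm (f₃ n) _) (partialSum-ac₀-tribonacci n)) ⟩
    2 * f₃ (suc (suc n)) ∎

  partialSum-ac₀-tribonacci : ∀ n → partialSum-ac₀ (suc n) + f₃ n ≡ f₃ (suc (suc n))
  partialSum-ac₀-tribonacci zero = refl
  partialSum-ac₀-tribonacci (suc n) = begin
    ac₀ (suc (suc n)) + partialSum-ac₀ (suc n) + f₃ (suc n)
      ≡⟨ cong (λ a → a + partialSum-ac₀ (suc n) + f₃ (suc n)) (ac₀-suc-suc-tribonacci n) ⟩
    2 * f₃ n + partialSum-ac₀ (suc n) + f₃ (suc n)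
      ≡⟨ regroup (f₃ n) (partialSum-ac₀ (suc n)) (f₃ (suc n)) ⟩
    partialSum-ac₀ (suc n) + f₃ n + f₃ (suc n) + f₃ n
      ≡⟨ cong (λ t → t + f₃ (suc n) + f₃ n) (partialSum-ac₀-tribonacci n) ⟩
    f₃ (suc (suc (suc n))) ∎
    where
    regroup : ∀ a c b → 2 * a + c + b ≡ c + a + b + a
    regroup = solve 3 (λ a c b → con 2 :* a :+ c :+ b := c :+ a :+ b :+ a) refl

theorem1 : (n : ℕ) → 1 ≤ n → ac₀ n ≡ 2 * f₃ (n ∸ 2)
theorem1 (suc zero) _ = refl
theorem1 (suc (suc m)) _ = ac₀-suc-suc-tribonacci m
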